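{- For all positive integers $n,k$ with $n\ge 2k$ we have $\chi(Q(n,k))=\left\lceil\frac{n}{k}\right\rceil$.
   Context: For a positive integer $n$ let $[n]=\{1,\dots,n\}$ and let $C_n$ be the cycle on $[n]$ with edges $\{i,i+1\}$ ($1\le i\le n-1$) and $\{n,1\}$. The Schrijver graph $\mathrm{SG}(n,k)$ ($n\ge 2k$) has as vertices the $k$-subsets of $[n]$ containing no two cyclically consecutive elements, two vertices adjacent iff they are disjoint. An arc of $C_n$ is a set $\{i,i+1,\dots,i+m-1\}$ (addition mod $n$) with $1\le m\le n-1$. A set $U\subseteq[n]$ is well-spread if for any two arcs $A,B$ with $|A|=|B|$ we have $\big||A\cap U|-|B\cap U|\big|\le 1$. $Q(n,k)$ is the induced subgraph of $\mathrm{SG}(n,k)$ on all well-spread $k$-subsets of $[n]$. $\chi$ denotes the chromatic number. -}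

module Defs where

open import Data.Nat using (ℕ; zero; suc; _+_; _≤_; _<_; _∸_; _*_)
open import Data.Nat.Properties using (_≟_)
open import Data.Nat.DivMod using (_/_)
open import Data.Fin using (Fin; toℕ; lower₁)
import Data.Fin as F
open import Data.Fin.Subset using (Subset; _∈_; _∉_; ∣_∣; Empty; _∩_; inside)
open import Data.Vec using (lookup)
open import Data.Bool using (Bool; true; false)
open import Data.Product using (Σ; _×_; _,_; proj₁)
open import Relation.Nullary using (¬_; yes; no)
open import Relation.Binary.PropositionalEquality using (_≡_; _≢_)

-- Convention: the ground set [n] = {1,…,n} is represented by Fin n = {0,…,n-1}
-- (element j+1 of [n] ↔ element j of Fin n); the cycle C_n becomes j ~ j+1 mod n.

csuc : {n : ℕ} → Fin n → Fin n
csuc {suc m} i with toℕ i ≟ m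
... | yes _ = F.zero
... | no ne = lower₁ (F.suc i) λ eq → ne (Data.Nat.Properties.suc-injective (Relation.Binary.PropositionalEquality.sym eq))
  where import Data.Nat.Properties

shift : {n : ℕ} → Fin n → ℕ → Fin n
shift i zero    = i
shift i (suc j) = csuc (shift i j)

ind : {n : ℕ} → Subset n → Fin n → ℕ
ind U x with lookup U x
... | true  = 1
... | false = 0

arcCount : {n : ℕ} → Subset n → Fin n → ℕ → ℕ
arcCount U i zero    = 0
arcCount U i (suc m) = ind U (shift i m) + arcCount U i m

Stable : {n : ℕ} → Subset n → Set
Stable U = ∀ i → i ∈ U → csuc i ∉ U

-- well-spread: for any two arcs A, B of the same length m (1 ≤ m ≤ n-1),
-- | |A ∩ U| - |B ∩ U| | ≤ 1
WellSpread : {n : ℕ} → Subset n → Set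
WellSpread {n} U = ∀ (m : ℕ) → 1 ≤ m → m ≤ n ∸ 1 → ∀ (i j : Fin n) →
  arcCount U i m ≤ arcCount U j m + 1

QVertex : ℕ → ℕ → Set
QVertex n k = Σ (Subset n) λ U → (∣ U ∣ ≡ k) × Stable U × WellSpread U

-- adjacency in Q(n,k) (induced from SG(n,k)): disjointness
QAdj : {n k : ℕ} → QVertex n k → QVertex n k → Set
QAdj u v = Empty (proj₁ u ∩ proj₁ v)

Colouring : ℕ → ℕ → ℕ → Set
Colouring n k c = Σ (QVertex n k → Fin c) λ f →
  ∀ u v → QAdj u v → f u ≢ f v

ChromaticNumberIs : ℕ → ℕ → ℕ → Set
ChromaticNumberIs n k c = Colouring n k c × (∀ c' → c' < c → ¬ Colouring n k c')

-- ceiling division ⌈n / k⌉ = ⌊(n + k - 1) / k⌋ for k ≥ 1 (value 0 for k = 0, never used)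
ceilDiv : ℕ → ℕ → ℕ
ceilDiv n zero    = 0
ceilDiv n (suc k) = (n + k) / suc k

{-# OPTIONS --safe #-}
-- ⌈n/k⌉ colours suffice. Put q = ⌈n/k⌉. If a well-spread k-set U missed the arc {0,…,q−1},
-- then every arc of length q would contain at most one element of U, and the k − 1 further
-- arcs of length q that cover the rest of the cycle would hold fewer than k elements. So U
-- can be coloured by an element it has below q; sets sharing that element are not disjoint.
--
-- Fewer colours do not suffice. For e ∈ ℕ the set B_e = {y : ⌊(yk+e)/n⌋ < ⌊((y+1)k+e)/n⌋}
-- is a vertex: arc counts telescope to differences ⌊(A+mk)/n⌋ − ⌊A/n⌋, which lie in
-- {⌊mk/n⌋, ⌊mk/n⌋ + 1}. Moreover B_b and B_(b+d) are disjoint when k ≤ d ≤ n − k. A c-colouring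
-- therefore yields g : ℕ → Fin c with g b ≢ g (b + d) for all such d. Inside a colour class
-- of {0,…,n−1}, offsets from its least element lie in [0,k) ∪ (n−k,n), and no two differ by
-- n − k; folding (n−k,n) onto (0,k) injects the class into Fin k, hence n ≤ c k.
module Submission where

open import Defs
open import Data.Bool using (Bool; true; false; T)
open import Data.Empty using (⊥-elim)
open import Data.Fin using (Fin; toℕ; fromℕ<)
import Data.Fin as F
import Data.Fin.Properties as FP
open import Data.Fin.Subset using (Subset; _∈_; _∉_; ∣_∣; Empty; _∩_)
open import Data.Fin.Subset.Properties using (x∈p∩q⁻; x∈p∩q⁺; _∈?_; ∣p∣≤n)
open import Data.Nat using (ℕ; zero; suc; _+_; _*_; _∸_; _≤_; _<_; z≤n; s≤s; z<s; NonZero; _<?_; _<ᵇ_)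
open import Data.Nat.Divisibility using (n∣m*n)
open import Data.Nat.DivMod
open import Data.Nat.Properties
open import Data.Nat.Tactic.RingSolver using (solve-∀)
open import Data.Product using (∃; _,_; _×_; proj₁; proj₂)
open import Data.Sum using (_⊎_; inj₁; inj₂)
open import Data.Unit using (tt)
open import Data.Vec using ([]; _∷_; lookup; tabulate)
open import Data.Vec.Properties using (lookup∘tabulate; []=⇒lookup; lookup⇒[]=)
open import Function using (_∘_)
open import Function.Bundles using (mk⇔)
open import Relation.Binary.PropositionalEquality
open import Relation.Nullary using (¬_; yes; no)
open import Relation.Nullary.Decidable using (_×-dec_; does-⇔)
open import Relation.Nullary.Reflects using (ofʸ; ofⁿ)
open import Relation.Unary using (Decidable)

sumRange : (ℕ → ℕ) → ℕ → ℕ → ℕ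
sumRange h a zero    = 0
sumRange h a (suc m) = h (a + m) + sumRange h a m

sumRange-cong : ∀ {h h'} a b m → (∀ t → t < m → h (a + t) ≡ h' (b + t)) →
                sumRange h a m ≡ sumRange h' b m
sumRange-cong a b zero    eq = refl
sumRange-cong a b (suc m) eq =
  cong₂ _+_ (eq m ≤-refl) (sumRange-cong a b m (λ t t<m → eq t (m<n⇒m<1+n t<m)))

sumRange-+ : ∀ h a m m' → sumRange h a (m + m') ≡ sumRange h a m + sumRange h (a + m) m'
sumRange-+ h a m zero    = trans (cong (sumRange h a) (+-identityʳ m)) (sym (+-identityʳ _))
sumRange-+ h a m (suc m') = begin
  sumRange h a (m + suc m')                             ≡⟨ cong (sumRange h a) (+-suc m m') ⟩
  h (a + (m + m')) + sumRange h a (m + m')              ≡⟨ cong₂ _+_ (cong h (sym (+-assoc a m m'))) (sumRange-+ h a m m') ⟩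
  h (a + m + m') + (sumRange h a m + sumRange h (a + m) m') ≡⟨ x+[y+z]≡y+[x+z] (h (a + m + m')) (sumRange h a m) (sumRange h (a + m) m') ⟩
  sumRange h a m + sumRange h (a + m) (suc m')          ∎
  where
    open ≡-Reasoning
    x+[y+z]≡y+[x+z] : ∀ x y z → x + (y + z) ≡ y + (x + z)
    x+[y+z]≡y+[x+z] = solve-∀

sumRange-mono-≤ : ∀ h a {m m'} → m ≤ m' → sumRange h a m ≤ sumRange h a m'
sumRange-mono-≤ h a {m} {m'} m≤m' =
  subst (sumRange h a m ≤_)
        (trans (sym (sumRange-+ h a m (m' ∸ m))) (cong (sumRange h a) (m+[n∸m]≡n m≤m')))
        (m≤m+n _ _)

sumRange-zeros : ∀ h a m → (∀ t → t < m → h (a + t) ≡ 0) → sumRange h a m ≡ 0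
sumRange-zeros h a zero    zeros = refl
sumRange-zeros h a (suc m) zeros =
  cong₂ _+_ (zeros m ≤-refl) (sumRange-zeros h a m (λ t t<m → zeros t (m<n⇒m<1+n t<m)))

sumRange-blocks : ∀ h q B → (∀ a → sumRange h a q ≤ B) → ∀ s a → sumRange h a (s * q) ≤ s * B
sumRange-blocks h q B window zero    a = z≤n
sumRange-blocks h q B window (suc s) a =
  subst (_≤ suc s * B) (sym (sumRange-+ h a q (s * q)))
        (+-mono-≤ (window a) (sumRange-blocks h q B window s (a + q)))

sumRange-telescope : ∀ h F → (∀ y → h y + F y ≡ F (suc y)) →
                     ∀ a m → sumRange h a m + F a ≡ F (a + m)
sumRange-telescope h F step a zero    = cong F (sym (+-identityʳ a))
sumRange-telescope h F step a (suc m) = begin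
  h (a + m) + sumRange h a m + F a   ≡⟨ +-assoc (h (a + m)) _ _ ⟩
  h (a + m) + (sumRange h a m + F a) ≡⟨ cong (h (a + m) +_) (sumRange-telescope h F step a m) ⟩
  h (a + m) + F (a + m)              ≡⟨ step (a + m) ⟩
  F (suc (a + m))                    ≡⟨ cong F (sym (+-suc a m)) ⟩
  F (a + suc m)                      ∎
  where open ≡-Reasoning

indicator : Bool → ℕ
indicator true  = 1
indicator false = 0

ind≡indicator∘lookup : ∀ {n} (U : Subset n) x → ind U x ≡ indicator (lookup U x)
ind≡indicator∘lookup U x with lookup U x
... | true  = refl
... | false = refl

∈⇒ind≡1 : ∀ {n} (U : Subset n) {x} → x ∈ U → ind U x ≡ 1
∈⇒ind≡1 U {x} x∈U = trans (ind≡indicator∘lookup U x) (cong indicator ([]=⇒lookup x∈U))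

ind≢0⇒∈ : ∀ {n} (U : Subset n) x → ind U x ≢ 0 → x ∈ U
ind≢0⇒∈ U x ind≢0 =
  lookup⇒[]= x U (indicator≢0⇒true (lookup U x) (ind≢0 ∘ trans (ind≡indicator∘lookup U x)))
  where
    indicator≢0⇒true : ∀ b → indicator b ≢ 0 → b ≡ true
    indicator≢0⇒true true  _  = refl
    indicator≢0⇒true false ≢0 = ⊥-elim (≢0 refl)

∣∣≡sumRange : ∀ {n} (U : Subset n) (h : ℕ → ℕ) →
              (∀ t (t<n : t < n) → h t ≡ indicator (lookup U (fromℕ< t<n))) →
              ∣ U ∣ ≡ sumRange h 0 n
∣∣≡sumRange [] h eq = refl
∣∣≡sumRange {suc n} (b ∷ U) h eq = begin
  ∣ b ∷ U ∣                      ≡⟨ ∣∷∣ b ⟩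
  indicator b + ∣ U ∣            ≡⟨ cong₂ _+_ (sym (eq 0 z<s)) (∣∣≡sumRange U (h ∘ suc) (λ t t<n → eq (suc t) (s≤s t<n))) ⟩
  h 0 + sumRange (h ∘ suc) 0 n   ≡⟨ cong₂ _+_ (sym (+-identityʳ (h 0))) (sumRange-cong 0 1 n (λ t _ → refl)) ⟩
  sumRange h 0 1 + sumRange h 1 n ≡⟨ sumRange-+ h 0 1 n ⟨
  sumRange h 0 (suc n)           ∎
  where
    open ≡-Reasoning
    ∣∷∣ : ∀ b → ∣ b ∷ U ∣ ≡ indicator b + ∣ U ∣
    ∣∷∣ true  = refl
    ∣∷∣ false = refl

module _ {n : ℕ} .{{_ : NonZero n}} where

  periodic-+* : ∀ {ℓ} {X : Set ℓ} (h : ℕ → X) → (∀ y → h (y + n) ≡ h y) →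
                ∀ z q → h (z + q * n) ≡ h z
  periodic-+* h periodic z zero    = cong h (+-identityʳ z)
  periodic-+* h periodic z (suc q) = begin
    h (z + (n + q * n)) ≡⟨ cong h (trans (cong (z +_) (+-comm n (q * n))) (sym (+-assoc z (q * n) n))) ⟩
    h (z + q * n + n)   ≡⟨ periodic (z + q * n) ⟩
    h (z + q * n)       ≡⟨ periodic-+* h periodic z q ⟩
    h z                 ∎
    where open ≡-Reasoning

  periodic-% : ∀ {ℓ} {X : Set ℓ} (h : ℕ → X) → (∀ y → h (y + n) ≡ h y) → ∀ y → h (y % n) ≡ h y
  periodic-% h periodic y =
    trans (sym (periodic-+* h periodic (y % n) (y / n))) (cong h (sym (m≡m%n+[m/n]*n y n)))

  *≤⇒≤/ : ∀ {a} q → q * n ≤ a → q ≤ a / n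
  *≤⇒≤/ {a} q q*n≤a = subst (_≤ a / n) (m*n/n≡m q n) (/-monoˡ-≤ n q*n≤a)

  <*⇒/≤ : ∀ {a} q → a < suc q * n → a / n ≤ q
  <*⇒/≤ q a<[1+q]*n = ≤-pred (m<n*o⇒m/o<n a<[1+q]*n)

  m<[1+m/n]*n : ∀ m → m < suc (m / n) * n
  m<[1+m/n]*n m = subst (_< suc (m / n) * n) (sym (m≡m%n+[m/n]*n m n))
                        (+-monoˡ-< ((m / n) * n) (m%n<n m n))

  [m+d]/n≤1+m/n : ∀ m {d} → d ≤ n → (m + d) / n ≤ suc (m / n)
  [m+d]/n≤1+m/n m {d} d≤n = <*⇒/≤ (suc (m / n))
    (subst (m + d <_) (+-comm (suc (m / n) * n) n) (+-mono-<-≤ (m<[1+m/n]*n m) d≤n))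

  m/n+d/n≤[m+d]/n : ∀ m d → m / n + d / n ≤ (m + d) / n
  m/n+d/n≤[m+d]/n m d = *≤⇒≤/ (m / n + d / n)
    (subst (_≤ m + d) (sym (*-distribʳ-+ n (m / n) (d / n))) (+-mono-≤ (m/n*n≤m m n) (m/n*n≤m d n)))

  [m+d]/n≤1+m/n+d/n : ∀ m d → (m + d) / n ≤ suc (m / n + d / n)
  [m+d]/n≤1+m/n+d/n m d = <*⇒/≤ (suc (m / n + d / n)) (begin-strict
    m + d                                    <⟨ +-monoʳ-< m (n<1+n d) ⟩
    m + suc d                                <⟨ +-mono-≤ (m<[1+m/n]*n m) (m<[1+m/n]*n d) ⟩
    suc (m / n) * n + suc (d / n) * n        ≡⟨ *-distribʳ-+ n (suc (m / n)) (suc (d / n)) ⟨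
    (suc (m / n) + suc (d / n)) * n          ≡⟨ cong (λ x → suc x * n) (+-suc (m / n) (d / n)) ⟩
    suc (suc (m / n + d / n)) * n            ∎)
    where open ≤-Reasoning

  [m+k*n]/n≡m/n+k : ∀ m k → (m + k * n) / n ≡ m / n + k
  [m+k*n]/n≡m/n+k m k = trans (+-distrib-/-∣ʳ m (n∣m*n k)) (cong (m / n +_) (m*n/n≡m k n))

module _ (n k' : ℕ) where

  n≤ceilDiv*k : n ≤ ceilDiv n (suc k') * suc k'
  n≤ceilDiv*k = +-cancelʳ-≤ k' n _ (≤-pred (begin-strict
    n + k'                                  ≡⟨ m≡m%n+[m/n]*n (n + k') (suc k') ⟩
    (n + k') % suc k' + ceilDiv n (suc k') * suc k' <⟨ +-monoˡ-< _ (m%n<n (n + k') (suc k')) ⟩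
    suc k' + ceilDiv n (suc k') * suc k'    ≡⟨ cong suc (+-comm k' _) ⟩
    suc (ceilDiv n (suc k') * suc k' + k')  ∎))
    where open ≤-Reasoning

  ceilDiv-least : ∀ c → n ≤ c * suc k' → ceilDiv n (suc k') ≤ c
  ceilDiv-least c n≤c*k = <*⇒/≤ c (begin-strict
    n + k'            <⟨ +-monoʳ-< n (n<1+n k') ⟩
    n + suc k'        ≤⟨ +-monoˡ-≤ (suc k') n≤c*k ⟩
    c * suc k' + suc k' ≡⟨ +-comm (c * suc k') (suc k') ⟩
    suc c * suc k'    ∎)
    where open ≤-Reasoning

  ceilDiv≤ : ceilDiv n (suc k') ≤ n
  ceilDiv≤ = ceilDiv-least n (m≤m*n n (suc k'))

  ceilDiv-pos : 1 ≤ n → 1 ≤ ceilDiv n (suc k')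
  ceilDiv-pos 1≤n = ≮⇒≥ λ q<1 → <⇒≱ 1≤n (≤-trans n≤ceilDiv*k (*-monoˡ-≤ (suc k') (≤-pred q<1)))

ceilDiv≤pred : ∀ n' j → 1 ≤ n' → ceilDiv (suc n') (2 + j) ≤ n'
ceilDiv≤pred n' j 1≤n' = ceilDiv-least (suc n') (suc j) n' (begin
  suc n'            ≤⟨ +-monoʳ-≤ 1 (m≤m*n n' (suc j)) ⟩
  1 + n' * suc j    ≤⟨ +-monoˡ-≤ (n' * suc j) 1≤n' ⟩
  n' + n' * suc j   ≡⟨ *-suc n' (suc j) ⟨
  n' * (2 + j)      ∎)
  where open ≤-Reasoning

module Cycle (n' : ℕ) where

  n : ℕ
  n = suc n'

  toℕ-csuc : (i : Fin n) → toℕ (csuc i) ≡ suc (toℕ i) % n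
  toℕ-csuc i with toℕ i ≟ n'
  ... | yes i≡n' rewrite i≡n' = sym (n%n≡0 n)
  ... | no  i≢n' = trans (FP.toℕ-lower₁ (F.suc i) (i≢n' ∘ suc-injective ∘ sym))
                         (sym (m<n⇒m%n≡m (s≤s (≤∧≢⇒< (≤-pred (FP.toℕ<n i)) i≢n'))))

  toℕ-mod : ∀ y → toℕ (y mod n) ≡ y % n
  toℕ-mod y = FP.toℕ-fromℕ< (m%n<n y n)

  shift≡mod : (i : Fin n) (t : ℕ) → shift i t ≡ (toℕ i + t) mod n
  shift≡mod i t = FP.toℕ-injective (trans (toℕ-shift t) (sym (toℕ-mod (toℕ i + t))))
    where
      toℕ-shift : ∀ t → toℕ (shift i t) ≡ (toℕ i + t) % n
      toℕ-shift zero    = trans (sym (m<n⇒m%n≡m (FP.toℕ<n i))) (cong (_% n) (sym (+-identityʳ (toℕ i))))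
      toℕ-shift (suc t) = begin
        toℕ (csuc (shift i t))   ≡⟨ toℕ-csuc (shift i t) ⟩
        suc (toℕ (shift i t)) % n ≡⟨ cong (λ x → suc x % n) (toℕ-shift t) ⟩
        suc ((toℕ i + t) % n) % n ≡⟨ [1+m%n]%n≡[1+m]%n (toℕ i + t) ⟩
        suc (toℕ i + t) % n       ≡⟨ cong (_% n) (sym (+-suc (toℕ i) t)) ⟩
        (toℕ i + suc t) % n       ∎
        where
          open ≡-Reasoning
          [1+m%n]%n≡[1+m]%n : ∀ m → suc (m % n) % n ≡ suc m % n
          [1+m%n]%n≡[1+m]%n m = trans (sym ([m+kn]%n≡m%n (suc (m % n)) (m / n) n))
                                      (cong (λ x → suc x % n) (sym (m≡m%n+[m/n]*n m n)))

  mod-fromℕ< : ∀ {t} (t<n : t < n) → t mod n ≡ fromℕ< t<n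
  mod-fromℕ< {t} t<n = FP.toℕ-injective
    (trans (toℕ-mod t) (trans (m<n⇒m%n≡m t<n) (sym (FP.toℕ-fromℕ< t<n))))

  χ : Subset n → ℕ → ℕ
  χ U y = ind U (y mod n)

  χ-periodic : ∀ U y → χ U (y + n) ≡ χ U y
  χ-periodic U y = cong (ind U) (FP.toℕ-injective
    (trans (toℕ-mod (y + n)) (trans ([m+n]%n≡m%n y n) (sym (toℕ-mod y)))))

  ∣∣≡sumRange-χ : ∀ U → ∣ U ∣ ≡ sumRange (χ U) 0 n
  ∣∣≡sumRange-χ U = ∣∣≡sumRange U (χ U) λ t t<n →
    trans (ind≡indicator∘lookup U (t mod n)) (cong (indicator ∘ lookup U) (mod-fromℕ< t<n))

  arcCount≡sumRange-χ : ∀ U i m → arcCount U i m ≡ sumRange (χ U) (toℕ i) m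
  arcCount≡sumRange-χ U i zero    = refl
  arcCount≡sumRange-χ U i (suc m) =
    cong₂ _+_ (cong (ind U) (shift≡mod i m)) (arcCount≡sumRange-χ U i m)

  sumRange-χ≡arcCount : ∀ U a m → sumRange (χ U) a m ≡ arcCount U (a mod n) m
  sumRange-χ≡arcCount U a m = begin
    sumRange (χ U) a m               ≡⟨ sumRange-cong a (a % n) m reduce ⟩
    sumRange (χ U) (a % n) m         ≡⟨ cong (λ x → sumRange (χ U) x m) (toℕ-mod a) ⟨
    sumRange (χ U) (toℕ (a mod n)) m ≡⟨ arcCount≡sumRange-χ U (a mod n) m ⟨
    arcCount U (a mod n) m           ∎
    where
      open ≡-Reasoning
      x+y+z≡x+z+y : ∀ x y z → x + y + z ≡ x + z + y
      x+y+z≡x+z+y = solve-∀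
      reduce : ∀ t → t < m → χ U (a + t) ≡ χ U (a % n + t)
      reduce t _ = begin
        χ U (a + t)                 ≡⟨ cong (λ x → χ U (x + t)) (m≡m%n+[m/n]*n a n) ⟩
        χ U (a % n + a / n * n + t) ≡⟨ cong (χ U) (x+y+z≡x+z+y (a % n) (a / n * n) t) ⟩
        χ U (a % n + t + a / n * n) ≡⟨ periodic-+* (χ U) (χ-periodic U) (a % n + t) (a / n) ⟩
        χ U (a % n + t)             ∎

  wellSpread⇒windows : ∀ {U} → WellSpread U → ∀ m → 1 ≤ m → m ≤ n' →
                       ∀ a b → sumRange (χ U) a m ≤ sumRange (χ U) b m + 1
  wellSpread⇒windows {U} ws m 1≤m m≤n' a b
    rewrite sumRange-χ≡arcCount U a m | sumRange-χ≡arcCount U b m =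
    ws m 1≤m m≤n' (a mod n) (b mod n)

module Beatty (n' k : ℕ) (k≤n : k ≤ suc n') where
  open Cycle n'

  level : ℕ → ℕ → ℕ
  level e y = (y * k + e) / n

  jump : ℕ → ℕ → Bool
  jump e y = level e y <ᵇ level e (suc y)

  beatty : ℕ → Subset n
  beatty e = tabulate (jump e ∘ toℕ)

  level-+ : ∀ e a m → level e (a + m) ≡ (a * k + e + m * k) / n
  level-+ e a m = cong (_/ n) (lemma a m k e)
    where
      lemma : ∀ a m k e → (a + m) * k + e ≡ a * k + e + m * k
      lemma = solve-∀

  level-suc : ∀ e y → level e (suc y) ≡ (y * k + e + k) / n
  level-suc e y = trans (cong (level e) (+-comm 1 y)) (trans (level-+ e y 1) (cong (λ x → (y * k + e + x) / n) (*-identityˡ k)))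

  level-periodic : ∀ e y → level e (y + n) ≡ level e y + k
  level-periodic e y = trans (level-+ e y n)
    (trans (cong (λ x → (y * k + e + x) / n) (*-comm n k)) ([m+k*n]/n≡m/n+k (y * k + e) k))

  indicator-jump : ∀ e y → indicator (jump e y) + level e y ≡ level e (suc y)
  indicator-jump e y with level e y <ᵇ level e (suc y) | <ᵇ-reflects-< (level e y) (level e (suc y))
  ... | true  | ofʸ lt  = ≤-antisym lt (subst (_≤ suc (level e y)) (sym (level-suc e y)) ([m+d]/n≤1+m/n (y * k + e) k≤n))
  ... | false | ofⁿ ¬lt = ≤-antisym (subst (level e y ≤_) (sym (level-suc e y)) (/-monoˡ-≤ n (m≤m+n (y * k + e) k))) (≮⇒≥ ¬lt)

  jump⇒< : ∀ e y → jump e y ≡ true → level e y < level e (suc y)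
  jump⇒< e y eq = <ᵇ⇒< (level e y) (level e (suc y)) (subst T (sym eq) tt)

  jump-periodic : ∀ e y → jump e (y + n) ≡ jump e y
  -- does (m <? n) reduces to m <ᵇ n.
  jump-periodic e y rewrite level-periodic e y | level-periodic e (suc y) =
    does-⇔ (mk⇔ (+-cancelʳ-< k (level e y) (level e (suc y))) (+-monoˡ-< k))
           (level e y + k <? level e (suc y) + k) (level e y <? level e (suc y))

  ∈beatty⇒ : ∀ e {x} → x ∈ beatty e → level e (toℕ x) < level e (suc (toℕ x))
  ∈beatty⇒ e {x} x∈ = jump⇒< e (toℕ x) (trans (sym (lookup∘tabulate (jump e ∘ toℕ) x)) ([]=⇒lookup x∈))

  χ-beatty : ∀ e y → χ (beatty e) y ≡ indicator (jump e y)
  χ-beatty e y = begin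
    ind (beatty e) (y mod n)                            ≡⟨ ind≡indicator∘lookup (beatty e) (y mod n) ⟩
    indicator (lookup (beatty e) (y mod n))             ≡⟨ cong indicator (lookup∘tabulate (jump e ∘ toℕ) (y mod n)) ⟩
    indicator (jump e (toℕ (y mod n)))                  ≡⟨ cong (indicator ∘ jump e) (toℕ-mod y) ⟩
    indicator (jump e (y % n))                          ≡⟨ cong indicator (periodic-% (jump e) (jump-periodic e) y) ⟩
    indicator (jump e y)                                ∎
    where open ≡-Reasoning

  beatty-window : ∀ e a m → sumRange (χ (beatty e)) a m + level e a ≡ level e (a + m)
  beatty-window e a m = trans
    (cong (_+ level e a) (sumRange-cong a a m (λ t _ → χ-beatty e (a + t))))
    (sumRange-telescope (indicator ∘ jump e) (level e) (indicator-jump e) a m)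

  ∣beatty∣ : ∀ e → ∣ beatty e ∣ ≡ k
  ∣beatty∣ e = +-cancelʳ-≡ (level e 0) _ _ (begin
    ∣ beatty e ∣ + level e 0                    ≡⟨ cong (_+ level e 0) (∣∣≡sumRange-χ (beatty e)) ⟩
    sumRange (χ (beatty e)) 0 n + level e 0     ≡⟨ beatty-window e 0 n ⟩
    level e n                                   ≡⟨ level-periodic e 0 ⟩
    level e 0 + k                               ≡⟨ +-comm (level e 0) k ⟩
    k + level e 0                               ∎)
    where open ≡-Reasoning

  beatty-window-bounds : ∀ e a m → let D = m * k in
    D / n ≤ sumRange (χ (beatty e)) a m × sumRange (χ (beatty e)) a m ≤ suc (D / n)
  beatty-window-bounds e a m =
      +-cancelʳ-≤ (level e a) _ _ (subst₂ _≤_ (+-comm (level e a) (D / n)) (sym window) (m/n+d/n≤[m+d]/n A D))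
    , +-cancelʳ-≤ (level e a) _ _ (subst₂ _≤_ (sym window) (cong suc (+-comm (level e a) (D / n))) ([m+d]/n≤1+m/n+d/n A D))
    where
      D = m * k
      A = a * k + e
      window : sumRange (χ (beatty e)) a m + level e a ≡ (A + D) / n
      window = trans (beatty-window e a m) (level-+ e a m)

  beatty-wellSpread : ∀ e → WellSpread (beatty e)
  beatty-wellSpread e m _ _ i j rewrite arcCount≡sumRange-χ (beatty e) i m | arcCount≡sumRange-χ (beatty e) j m =
    ≤-trans (proj₂ (beatty-window-bounds e (toℕ i) m))
            (subst (suc ((m * k) / n) ≤_) (+-comm 1 _) (s≤s (proj₁ (beatty-window-bounds e (toℕ j) m))))

  beatty-stable : 2 * k ≤ n → ∀ e → Stable (beatty e)
  beatty-stable 2k≤n e x x∈ csucx∈ = 1+n≰n (begin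
    2 + level e a                          ≡⟨ cong (_+ level e a) (sym arc≡2) ⟩
    sumRange (χ (beatty e)) a 2 + level e a ≡⟨ beatty-window e a 2 ⟩
    level e (a + 2)                        ≡⟨ level-+ e a 2 ⟩
    (a * k + e + 2 * k) / n                ≤⟨ [m+d]/n≤1+m/n (a * k + e) 2k≤n ⟩
    suc (level e a)                        ∎)
    where
      open ≤-Reasoning
      a = toℕ x
      arc≡2 : sumRange (χ (beatty e)) a 2 ≡ 2
      arc≡2 = trans (sym (arcCount≡sumRange-χ (beatty e) x 2))
                    (cong₂ _+_ (∈⇒ind≡1 (beatty e) csucx∈) (cong (_+ 0) (∈⇒ind≡1 (beatty e) x∈)))

  beatty-disjoint : ∀ b d → k ≤ d → d + k ≤ n → Empty (beatty b ∩ beatty (b + d))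
  beatty-disjoint b d k≤d d+k≤n (x , x∈∩) = <⇒≱ jump[b+d] (begin
    level (b + d) (suc y)   ≡⟨ level-suc (b + d) y ⟩
    (y * k + (b + d) + k) / n ≡⟨ cong (_/ n) (regroup (y * k) b d k) ⟩
    (A + (d + k)) / n       ≤⟨ [m+d]/n≤1+m/n A d+k≤n ⟩
    suc (A / n)             ≤⟨ *≤⇒≤/ (suc (A / n)) (≤-trans (*-monoˡ-≤ n jump[b]) (m/n*n≤m (A + k) n)) ⟩
    (A + k) / n             ≤⟨ /-monoˡ-≤ n (+-monoʳ-≤ A k≤d) ⟩
    (A + d) / n             ≡⟨ cong (_/ n) (+-assoc (y * k) b d) ⟩
    level (b + d) y         ∎)
    where
      open ≤-Reasoning
      y = toℕ x
      A = y * k + b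
      regroup : ∀ p b d k → p + (b + d) + k ≡ p + b + (d + k)
      regroup = solve-∀
      jump[b] : A / n < (A + k) / n
      jump[b] = subst (A / n <_) (level-suc b y) (∈beatty⇒ b (proj₁ (x∈p∩q⁻ _ _ x∈∩)))
      jump[b+d] : level (b + d) y < level (b + d) (suc y)
      jump[b+d] = ∈beatty⇒ (b + d) (proj₂ (x∈p∩q⁻ _ _ x∈∩))

  beattyVertex : 2 * k ≤ n → ℕ → QVertex n k
  beattyVertex 2k≤n e = beatty e , ∣beatty∣ e , beatty-stable 2k≤n e , beatty-wellSpread e

module _ {p} {P : ℕ → Set p} (P? : Decidable P) where

  least : ∀ {b} → P b → ∃ λ a → P a × (∀ {t} → t < a → ¬ P t)
  least {b} Pb = search 0 b (λ ()) Pb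
    where
      search : ∀ a f → (∀ {t} → t < a → ¬ P t) → P (a + f) → ∃ λ a → P a × (∀ {t} → t < a → ¬ P t)
      search a zero    below Pa+f = a , subst P (+-identityʳ a) Pa+f , below
      search a (suc f) below Pa+f with P? a
      ... | yes Pa = a , Pa , below
      ... | no ¬Pa = search (suc a) f below′ (subst P (+-suc a f) Pa+f)
        where
          below′ : ∀ {t} → t < suc a → ¬ P t
          below′ t<1+a with m≤n⇒m<n∨m≡n (≤-pred t<1+a)
          ... | inj₁ t<a  = below t<a
          ... | inj₂ refl = ¬Pa

module GapColouring {n k c : ℕ} (2k≤n : 2 * k ≤ n) (g : ℕ → Fin c)
                    (gap : ∀ b d → k ≤ d → d + k ≤ n → g b ≢ g (b + d)) where

  k≤n : k ≤ n
  k≤n = ≤-trans (m≤m+n k (k + 0)) 2k≤n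

  k≤n∸k : k ≤ n ∸ k
  k≤n∸k = m+n≤o⇒m≤o∸n k (subst (_≤ n) (cong (k +_) (+-identityʳ k)) 2k≤n)

  anchor : ℕ → ℕ
  anchor e = proj₁ (least (λ t → g t FP.≟ g e) {e} refl)

  anchor-colour : ∀ e → g (anchor e) ≡ g e
  anchor-colour e = proj₁ (proj₂ (least (λ t → g t FP.≟ g e) {e} refl))

  anchor-minimal : ∀ e {t} → t < anchor e → g t ≢ g e
  anchor-minimal e = proj₂ (proj₂ (least (λ t → g t FP.≟ g e) {e} refl))

  anchor≤ : ∀ e → anchor e ≤ e
  anchor≤ e = ≮⇒≥ (λ e<anchor → anchor-minimal e e<anchor refl)

  anchor-cong : ∀ {e e'} → g e ≡ g e' → anchor e ≡ anchor e'
  anchor-cong {e} {e'} ge≡ge' = ≤-antisym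
    (≮⇒≥ (λ a'<a → anchor-minimal e a'<a (trans (anchor-colour e') (sym ge≡ge'))))
    (≮⇒≥ (λ a<a' → anchor-minimal e' a<a' (trans (anchor-colour e) ge≡ge')))

  offset : ℕ → ℕ
  offset e = e ∸ anchor e

  anchor+offset : ∀ e → anchor e + offset e ≡ e
  anchor+offset e = m+[n∸m]≡n (anchor≤ e)

  offset-wraps : ∀ e → k ≤ offset e → n < offset e + k
  offset-wraps e k≤d = ≰⇒> (λ d+k≤n → gap (anchor e) (offset e) k≤d d+k≤n
    (trans (anchor-colour e) (cong g (sym (anchor+offset e)))))

  fold : ℕ → ℕ
  fold d with d <? k
  ... | yes _ = d
  ... | no  _ = d + k ∸ n

  fold<k : ∀ {d} → d < n → (k ≤ d → n < d + k) → fold d < k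
  fold<k {d} d<n wraps with d <? k
  ... | yes d<k = d<k
  ... | no  d≮k = subst (d + k ∸ n <_) (m+n∸m≡n n k) (∸-monoˡ-< (+-monoˡ-< k d<n) (<⇒≤ (wraps (≮⇒≥ d≮k))))

  unfold : ∀ {d} → n < d + k → (d + k ∸ n) + (n ∸ k) ≡ d
  unfold {d} n<d+k = +-cancelʳ-≡ k _ _ (begin
    d + k ∸ n + (n ∸ k) + k   ≡⟨ +-assoc (d + k ∸ n) (n ∸ k) k ⟩
    d + k ∸ n + (n ∸ k + k)   ≡⟨ cong (d + k ∸ n +_) (m∸n+n≡m k≤n) ⟩
    d + k ∸ n + n             ≡⟨ m∸n+n≡m (<⇒≤ n<d+k) ⟩
    d + k                     ∎)
    where open ≡-Reasoning

  fold-collision : ∀ {d d'} → (k ≤ d → n < d + k) → (k ≤ d' → n < d' + k) → fold d ≡ fold d' →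
                   d ≡ d' ⊎ d' ≡ d + (n ∸ k) ⊎ d ≡ d' + (n ∸ k)
  fold-collision {d} {d'} wraps wraps' eq with d <? k | d' <? k
  ... | yes _   | yes _    = inj₁ eq
  ... | no  d≮k | no  d'≮k = inj₁ (+-cancelʳ-≡ k d d'
    (∸-cancelʳ-≡ (<⇒≤ (wraps (≮⇒≥ d≮k))) (<⇒≤ (wraps' (≮⇒≥ d'≮k))) eq))
  ... | yes _   | no  d'≮k = inj₂ (inj₁ (trans (sym (unfold (wraps' (≮⇒≥ d'≮k)))) (cong (_+ (n ∸ k)) (sym eq))))
  ... | no  d≮k | yes _    = inj₂ (inj₂ (trans (sym (unfold (wraps (≮⇒≥ d≮k)))) (cong (_+ (n ∸ k)) eq)))

  no-antipodal-offsets : ∀ {e e'} → g e ≡ g e' → offset e' ≢ offset e + (n ∸ k)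
  no-antipodal-offsets {e} {e'} ge≡ge' eq = gap e (n ∸ k) k≤n∸k (≤-reflexive (m∸n+n≡m k≤n))
    (trans ge≡ge' (cong g (begin
      e'                              ≡⟨ anchor+offset e' ⟨
      anchor e' + offset e'           ≡⟨ cong₂ _+_ (anchor-cong ge≡ge') (sym eq) ⟨
      anchor e + (offset e + (n ∸ k)) ≡⟨ +-assoc (anchor e) (offset e) (n ∸ k) ⟨
      anchor e + offset e + (n ∸ k)   ≡⟨ cong (_+ (n ∸ k)) (anchor+offset e) ⟩
      e + (n ∸ k)                     ∎)))
    where open ≡-Reasoning

  label : Fin n → Fin (c * k)
  label x = F.combine (g e) (fromℕ< (fold<k offset<n (offset-wraps e)))
    where
      e = toℕ x
      offset<n : offset e < n
      offset<n = ≤-<-trans (m∸n≤m e (anchor e)) (FP.toℕ<n x)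

  label-injective : ∀ {x x'} → label x ≡ label x' → x ≡ x'
  label-injective {x} {x'} label≡
    with ge≡ge' , residue≡ ← FP.combine-injective _ _ _ _ label≡
    with fold-collision (offset-wraps (toℕ x)) (offset-wraps (toℕ x')) (FP.fromℕ<-injective _ _ _ _ residue≡)
  ... | inj₁ offset≡ = FP.toℕ-injective (begin
    toℕ x                             ≡⟨ anchor+offset (toℕ x) ⟨
    anchor (toℕ x) + offset (toℕ x)   ≡⟨ cong₂ _+_ (anchor-cong ge≡ge') offset≡ ⟩
    anchor (toℕ x') + offset (toℕ x') ≡⟨ anchor+offset (toℕ x') ⟩
    toℕ x'                            ∎)
    where open ≡-Reasoning
  ... | inj₂ (inj₁ offset'≡) = ⊥-elim (no-antipodal-offsets ge≡ge' offset'≡)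
  ... | inj₂ (inj₂ offset≡)  = ⊥-elim (no-antipodal-offsets (sym ge≡ge') offset≡)

  n≤c*k : n ≤ c * k
  n≤c*k = ≮⇒≥ λ c*k<n → let (x , x' , x<x' , label≡) = FP.pigeonhole c*k<n label in
    <-irrefl (cong toℕ (label-injective label≡)) x<x'

module Prefix (n' : ℕ) where
  open Cycle n'

  avoiding-prefix⇒sum≡0 : ∀ {U q} → q ≤ n → (∀ x → toℕ x < q → x ∉ U) → sumRange (χ U) 0 q ≡ 0
  avoiding-prefix⇒sum≡0 {U} {q} q≤n avoids = sumRange-zeros (χ U) 0 q zero-below
    where
      zero-below : ∀ t → t < q → χ U t ≡ 0
      zero-below t t<q with ind U (t mod n) ≟ 0
      ... | yes ind≡0 = ind≡0
      ... | no  ind≢0 = ⊥-elim (avoids (t mod n) t′<q (ind≢0⇒∈ U (t mod n) ind≢0))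
        where
          t′<q : toℕ (t mod n) < q
          t′<q = subst (_< q) (sym (trans (toℕ-mod t) (m<n⇒m%n≡m (<-≤-trans t<q q≤n)))) t<q

  tail-bound : ∀ k' {U} → suc k' ≤ n → WellSpread U → let q = ceilDiv n (suc k') in
               sumRange (χ U) 0 q ≡ 0 → sumRange (χ U) q (k' * q) ≤ k'
  tail-bound zero    k≤n ws prefix≡0 = z≤n
  tail-bound (suc j) {U} k≤n ws prefix≡0 =
    subst (sumRange (χ U) q (suc j * q) ≤_) (*-identityʳ (suc j)) (sumRange-blocks (χ U) q 1 window (suc j) q)
    where
      q = ceilDiv n (2 + j)
      window : ∀ a → sumRange (χ U) a q ≤ 1
      window a = ≤-trans
        (wellSpread⇒windows ws q (ceilDiv-pos n (suc j) (s≤s z≤n)) (ceilDiv≤pred n' j (≤-trans (s≤s z≤n) (≤-pred k≤n))) a 0)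
        (≤-reflexive (cong (_+ 1) prefix≡0))

  wellSpread-meets-prefix : ∀ k' {U} → ∣ U ∣ ≡ suc k' → WellSpread U →
                            ∃ λ x → toℕ x < ceilDiv n (suc k') × x ∈ U
  wellSpread-meets-prefix k' {U} ∣U∣≡k ws with FP.any? (λ x → (toℕ x <? ceilDiv n (suc k')) ×-dec (x ∈? U))
  ... | yes hit  = hit
  ... | no  ¬hit = ⊥-elim (1+n≰n (begin
    suc k'                                         ≡⟨ ∣U∣≡k ⟨
    ∣ U ∣                                          ≡⟨ ∣∣≡sumRange-χ U ⟩
    sumRange (χ U) 0 n                             ≤⟨ sumRange-mono-≤ (χ U) 0 n≤k*q ⟩
    sumRange (χ U) 0 (q + k' * q)                  ≡⟨ sumRange-+ (χ U) 0 q (k' * q) ⟩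
    sumRange (χ U) 0 q + sumRange (χ U) q (k' * q) ≡⟨ cong (_+ sumRange (χ U) q (k' * q)) prefix≡0 ⟩
    sumRange (χ U) q (k' * q)                      ≤⟨ tail-bound k' k≤n ws prefix≡0 ⟩
    k'                                             ∎))
    where
      open ≤-Reasoning
      q = ceilDiv n (suc k')
      k≤n : suc k' ≤ n
      k≤n = subst (_≤ n) ∣U∣≡k (∣p∣≤n U)
      n≤k*q : n ≤ suc k' * q
      n≤k*q = subst (n ≤_) (*-comm q (suc k')) (n≤ceilDiv*k n k')
      prefix≡0 : sumRange (χ U) 0 q ≡ 0
      prefix≡0 = avoiding-prefix⇒sum≡0 (ceilDiv≤ n k') (λ x x<q x∈U → ¬hit (x , x<q , x∈U))

module ChromaticNumber (n' k' : ℕ) (2k≤n : 2 * suc k' ≤ suc n') where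
  open Cycle n'
  open Beatty n' (suc k') (≤-trans (m≤m+n (suc k') (suc k' + 0)) 2k≤n)
  open Prefix n'

  k : ℕ
  k = suc k'

  q : ℕ
  q = ceilDiv n k

  prefixColouring : Colouring n k q
  prefixColouring = colour , proper
    where
      hit : (u : QVertex n k) → ∃ λ x → toℕ x < q × x ∈ proj₁ u
      hit (U , ∣U∣≡k , _ , ws) = wellSpread-meets-prefix k' ∣U∣≡k ws
      colour : QVertex n k → Fin q
      colour u = fromℕ< (proj₁ (proj₂ (hit u)))
      proper : ∀ u v → QAdj u v → colour u ≢ colour v
      proper u v disjoint colour≡ = disjoint (proj₁ (hit u) , x∈p∩q⁺ (proj₂ (proj₂ (hit u)) , x∈v))
        where
          x∈v : proj₁ (hit u) ∈ proj₁ v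
          x∈v = subst (_∈ proj₁ v) (sym (FP.toℕ-injective (FP.fromℕ<-injective _ _ _ _ colour≡))) (proj₂ (proj₂ (hit v)))

  no-smaller-colouring : ∀ c → c < q → ¬ Colouring n k c
  no-smaller-colouring c c<q (f , proper) = <⇒≱ c<q (ceilDiv-least n k' c n≤c*k)
    where
      n≤c*k : n ≤ c * k
      n≤c*k = GapColouring.n≤c*k 2k≤n (f ∘ beattyVertex 2k≤n)
                (λ b d k≤d d+k≤n → proper _ _ (beatty-disjoint b d k≤d d+k≤n))

proposition25 : (n k : ℕ) → 1 ≤ k → 2 * k ≤ n → ChromaticNumberIs n k (ceilDiv n k)
proposition25 n        zero     ()  _
proposition25 zero     (suc k') _   ()
proposition25 (suc n') (suc k') _   2k≤n = prefixColouring , no-smaller-colouring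
  where open ChromaticNumber n' k' 2k≤n
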